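{- Let $\mathbb H$ be a connected linear graph and let $\mathbf H = \operatorname{rel}(\mathbb H)$ be its tree order relaxation. Then for every pair of vertices $x, y \in V(\mathbf H)$ which are incomparable under $\preccurlyeq_{\mathbf H}$, and every path $P$ in $H$ from $x$ to $y$, neither $x$ nor $y$ is the $\preccurlyeq_{\mathbf H}$-minimum of $V(P)$.
   Context: A tree order on a finite set $S$ is a partial order $\preccurlyeq$ such that for every $x \in S$ the set $\{y : y \preccurlyeq x\}$ is totally ordered by $\preccurlyeq$. A tree-ordered graph (tog) $\mathbf G = (G, \preccurlyeq_{\mathbf G})$ is a finite graph $G$ together with a tree order $\preccurlyeq_{\mathbf G}$ on $V(G)$ such that for every edge $uv \in E(G)$ either $u \preccurlyeq_{\mathbf G} v$ or $v \preccurlyeq_{\mathbf G} u$. If the order is total, the tog is a linear graph. For a connected linear graph $\mathbb H$ (graph $H$ with a linear order of its vertices), its elimination tree $\operatorname{ET}(\mathbb H)$ is defined recursively: let $x$ be the minimum vertex of $\mathbb H$ and $\mathbb K_1, \dots, \mathbb K_s$ the connected components of $\mathbb H - x$ (with the induced order); then $\operatorname{ET}(\mathbb H)$ is the rooted tree with root $x$ whose children are the roots of $\operatorname{ET}(\mathbb K_1), \dots, \operatorname{ET}(\mathbb K_s)$. The tree order relaxation $\operatorname{rel}(\mathbb H)$ is the tog $(H, \preccurlyeq)$ where $u \preccurlyeq v$ iff $u$ lies on the path from the root of $\operatorname{ET}(\mathbb H)$ to $v$. -}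

module Defs where

open import Data.Nat using (ℕ)
open import Data.Fin using (Fin)
open import Data.Fin.Base using (_≤_)
open import Data.Fin.Subset using (Subset; _∈_; _∉_; _⊆_; _-_; Nonempty) renaming (⊤ to Full)
open import Data.List using (List; []; _∷_)
open import Data.List.Membership.Propositional using () renaming (_∈_ to _∈ₗ_)
open import Data.List.Relation.Unary.Unique.Propositional using (Unique)
open import Data.Product using (_×_)
open import Relation.Nullary using (¬_)
open import Relation.Binary.PropositionalEquality using (_≡_; _≢_)

record Graph (n : ℕ) : Set₁ where
  field
    Adj     : Fin n → Fin n → Set
    Adj-sym : ∀ {u v} → Adj u v → Adj v u
    Adj-irr : ∀ {u} → ¬ Adj u u
open Graph public

-- A linear graph: a graph G on Fin n, linearly ordered by the natural
-- order _≤_ of Fin n (every finite linear order is of this form).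

module _ {n : ℕ} (G : Graph n) where

  data Reach (S : Subset n) : Fin n → Fin n → Set where
    here : ∀ {a} → a ∈ S → Reach S a a
    step : ∀ {a b c} → a ∈ S → Adj G a b → Reach S b c → Reach S a c

  -- G[S] is connected (we also require S nonempty, as for connected graphs).
  Connected : Subset n → Set
  Connected S = Nonempty S × (∀ {a b} → a ∈ S → b ∈ S → Reach S a b)

  IsComponent : Subset n → Subset n → Set
  IsComponent T K =
    K ⊆ T × Connected K ×
    (∀ {a b} → a ∈ K → b ∈ T → Adj G a b → b ∈ K)

  IsMin : Subset n → Fin n → Set
  IsMin S x = x ∈ S × (∀ {y} → y ∈ S → x ≤ y)

  -- ETAnc S u v : in the elimination tree ET(G[S]) (recursively defined),
  -- u lies on the path from the root to v.  The root of ET(G[S]) is the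
  -- minimum x of S; the subtrees are ET(G[K]) for the components K of
  -- G[S] - x.
  data ETAnc (S : Subset n) : Fin n → Fin n → Set where
    root : ∀ {x v} → IsMin S x → v ∈ S → ETAnc S x v
    down : ∀ {x K u v} → IsMin S x → IsComponent (S - x) K →
           ETAnc K u v → ETAnc S u v

  -- The tree order of the relaxation rel(H) of the linear graph H = (G, ≤).
  _≼_ : Fin n → Fin n → Set
  u ≼ v = ETAnc Full u v

  Incomparable : Fin n → Fin n → Set
  Incomparable u v = ¬ (u ≼ v) × ¬ (v ≼ u)

  data Walk : Fin n → Fin n → Set where
    [_] : ∀ x → Walk x x
    _∷⟨_⟩_ : ∀ x {y z} → Adj G x y → Walk y z → Walk x z

  verts : ∀ {x y} → Walk x y → List (Fin n)
  verts [ x ] = x ∷ []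
  verts (x ∷⟨ _ ⟩ w) = x ∷ verts w

  IsPath : ∀ {x y} → Walk x y → Set
  IsPath w = Unique (verts w)

  IsRelMinOf : ∀ {x y} → Walk x y → Fin n → Set
  IsRelMinOf w m = m ∈ₗ verts w × (∀ {v} → v ∈ₗ verts w → m ≼ v)

-- Both endpoints x and y of a walk P occur in its vertex
-- list V(P).  A ≼-minimum m of V(P) lies below every vertex of V(P), in
-- particular below both endpoints.  Hence if x were the minimum we would
-- get x ≼ y, and if y were the minimum we would get y ≼ x; either
-- contradicts the incomparability of x and y.
module Submission where

open import Defs
open import Data.Nat using (ℕ)
open import Data.Fin using (Fin)
open import Data.Fin.Subset using () renaming (⊤ to Full)
open import Data.Product using (_×_; _,_; proj₁; proj₂)
open import Relation.Nullary using (¬_)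
open import Data.List.Relation.Unary.Any using (here; there)
open import Relation.Binary.PropositionalEquality using (refl)
open import Data.List.Membership.Propositional using () renaming (_∈_ to _∈ₗ_)

module _ {n : ℕ} (G : Graph n) where

  start∈verts : ∀ {x y} (w : Walk G x y) → x ∈ₗ verts G w
  start∈verts [ x ]          = here refl
  start∈verts (x ∷⟨ _ ⟩ _) = here refl

  end∈verts : ∀ {x y} (w : Walk G x y) → y ∈ₗ verts G w
  end∈verts [ x ]          = here refl
  end∈verts (x ∷⟨ _ ⟩ w) = there (end∈verts w)

  relMin-below-ends : ∀ {x y m} (w : Walk G x y) → IsRelMinOf G w m →
                      _≼_ G m x × _≼_ G m y
  relMin-below-ends w (_ , below) = below (start∈verts w) , below (end∈verts w)

corollary1 : ∀ {n} (G : Graph n) → Connected G Full →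
    ∀ (x y : Fin n) → Incomparable G x y →
    ∀ (P : Walk G x y) → IsPath G P →
    ¬ IsRelMinOf G P x × ¬ IsRelMinOf G P y
corollary1 G _ x y (x⋠y , y⋠x) P _ =
  (λ x-min → x⋠y (proj₂ (relMin-below-ends G P x-min))) ,
  (λ y-min → y⋠x (proj₁ (relMin-below-ends G P y-min)))
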